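{- (1) Every strong 1-faster-than relation is a strong c-faster-than relation. (2) Every strong 2-faster-than relation is a strong c-faster-than relation.
   Context: TACS. Fix a countable set $\Lambda$ of action names; $\overline{\Lambda}=\{\overline a : a\in\Lambda\}$ with $\overline{\overline a}=a$; $\mathcal A=\Lambda\cup\overline\Lambda\cup\{\tau\}$ is the set of actions (ranged over by $\alpha$), and $a$ ranges over $\Lambda\cup\overline\Lambda$. Terms are generated by $P::=\mathbf 0\mid x\mid \alpha.P\mid \sigma.P\mid P+P\mid P|P\mid P\backslash L\mid P[f]\mid \mu x.P$, where $x$ ranges over variables, $L\subseteq\mathcal A\setminus\{\tau\}$ is finite, and $f:\mathcal A\to\mathcal A$ satisfies $f(\tau)=\tau$, $f(\overline a)=\overline{f(a)}$ and $f(\alpha)\neq\alpha$ for only finitely many $\alpha$. $\mu x$ binds $x$; $P[Q/x]$ is substitution. In every term $\mu x.P$, $x$ must be guarded in $P$ (every occurrence in the scope of an action prefix). Processes (set $\mathcal P$) are closed terms. $\overline L=\{\overline a: a\in L\}$. Urgent sets: $\mathcal U(\sigma.P)=\mathcal U(\mathbf 0)=\mathcal U(x)=\emptyset$, $\mathcal U(\alpha.P)=\{\alpha\}$, $\mathcal U(P+Q)=\mathcal U(P)\cup\mathcal U(Q)$, $\mathcal U(P|Q)=\mathcal U(P)\cup\mathcal U(Q)\cup\{\tau\mid \mathcal U(P)\cap\overline{\mathcal U(Q)}\neq\emptyset\}$, $\mathcal U(P\backslash L)=\mathcal U(P)\setminus(L\cup\overline L)$, $\mathcal U(P[f])=\{f(\alpha):\alpha\in\mathcal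 U(P)\}$, $\mathcal U(\mu x.P)=\mathcal U(P)$. Action transitions $\xrightarrow{\alpha}$ are the least relations with: $\alpha.P\xrightarrow{\alpha}P$; if $P\xrightarrow{\alpha}P'$ then $\sigma.P\xrightarrow{\alpha}P'$, $\mu x.P\xrightarrow{\alpha}P'[\mu x.P/x]$, $P+Q\xrightarrow{\alpha}P'$, $Q+P\xrightarrow{\alpha}P'$, $P|Q\xrightarrow{\alpha}P'|Q$, $Q|P\xrightarrow{\alpha}Q|P'$, $P[f]\xrightarrow{f(\alpha)}P'[f]$, and $P\backslash L\xrightarrow{\alpha}P'\backslash L$ if $\alpha\notin L\cup\overline L$; if $P\xrightarrow{a}P'$ and $Q\xrightarrow{\overline a}Q'$ then $P|Q\xrightarrow{\tau}P'|Q'$. Clock transitions $\xrightarrow{\sigma}_i$ ($i\in\{1,2\}$) are the least relations with: $\mathbf 0\xrightarrow{\sigma}_i\mathbf 0$; $a.P\xrightarrow{\sigma}_i a.P$ for $a\in\Lambda\cup\overline\Lambda$; $\sigma.P\xrightarrow{\sigma}_iP$; if $P\xrightarrow{\sigma}_iP'$ then $\mu x.P\xrightarrow{\sigma}_iP'[\mu x.P/x]$, $P\backslash L\xrightarrow{\sigma}_iP'\backslash L$, $P[f]\xrightarrow{\sigma}_iP'[f]$; if $P\xrightarrow{\sigma}_iP'$ and $Q\xrightarrow{\sigma}_iQ'$ then $P+Q\xrightarrow{\sigma}_iP'+Q'$, and $P|Q\xrightarrow{\sigma}_iP'|Q'$ provided $\tau\notin\mathcal U(P|Q)$; and, only for $i=2$: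 if $P\xrightarrow{\sigma}_2P'$ then $\sigma.P\xrightarrow{\sigma}_2P'$. For $i\in\{1,2\}$, $\mathcal R\subseteq\mathcal P\times\mathcal P$ is a strong i-faster-than relation if for all $(P,Q)\in\mathcal R$, $\alpha\in\mathcal A$: (1) $P\xrightarrow{\alpha}P'$ implies $\exists Q'$. $Q\xrightarrow{\alpha}Q'$, $(P',Q')\in\mathcal R$; (2) $Q\xrightarrow{\alpha}Q'$ implies $\exists P'$. $P\xrightarrow{\alpha}P'$, $(P',Q')\in\mathcal R$; (3) $P\xrightarrow{\sigma}_iP'$ implies $\mathcal U(Q)\subseteq\mathcal U(P)$ and $\exists Q'$. $Q\xrightarrow{\sigma}_iQ'$, $(P',Q')\in\mathcal R$. $\mathcal R$ is a strong c-faster-than relation if it satisfies (1), (2) and (3') $P\xrightarrow{\sigma}_1P'$ implies $\mathcal U(Q)\subseteq\mathcal U(P)$ and $\exists Q'$. $Q\xrightarrow{\sigma}_2Q'$, $(P',Q')\in\mathcal R$. -}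

module Defs where

open import Data.Nat using (ℕ; zero; suc)
open import Data.Fin using (Fin; zero; suc)
open import Data.List using (List)
open import Data.List.Membership.Propositional using (_∈_; _∉_)
open import Data.Product using (Σ; _×_; ∃; _,_)
open import Data.Sum using (_⊎_)
open import Data.Unit using (⊤)
open import Data.Empty using (⊥)
open import Relation.Nullary using (¬_)
open import Relation.Binary.PropositionalEquality using (_≡_; _≢_)

-- Actions.  Λ = ℕ (a countable set of action names).

-- Visible actions: Λ ∪ Λ̄
data Vis : Set where
  nm : ℕ → Vis
  co : ℕ → Vis

bar : Vis → Vis
bar (nm a) = co a
bar (co a) = nm a

data Act : Set where
  vis : Vis → Act
  τ   : Act

-- Relabelling functions f : 𝒜 → 𝒜 with f(τ) = τ, f(ā) = \overline{f(a)}
-- and finite support.  (f(a) ≠ τ for visible a is forced by the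
-- condition f(ā) = \overline{f(a)}, since τ has no complement.)
record Relabel : Set where
  field
    fn      : Vis → Vis
    fn-bar  : ∀ a → fn (bar a) ≡ bar (fn a)
    finite  : Σ (List Vis) λ S → ∀ a → a ∉ S → fn a ≡ a

appRel : Relabel → Act → Act
appRel f (vis a) = vis (Relabel.fn f a)
appRel f τ       = τ

-- Restriction sets: finite subsets of 𝒜 ∖ {τ}, as lists of visible actions.
Restr : Set
Restr = List Vis

NotIn : Restr → Act → Set
NotIn L (vis a) = (a ∉ L) × (bar a ∉ L)
NotIn L τ       = ⊤

-- Terms, with de Bruijn variables: Term n has at most n free variables.

data Term (n : ℕ) : Set where
  𝟎    : Term n
  var  : Fin n → Term n
  _∙_  : Act → Term n → Term n
  σ∙_  : Term n → Term n
  _⊕_  : Term n → Term n → Term n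
  _∣∣_ : Term n → Term n → Term n
  _∖_  : Term n → Restr → Term n
  _⟦_⟧ : Term n → Relabel → Term n
  μ_   : Term (suc n) → Term n

lift : ∀ {m n} → (Fin m → Fin n) → Fin (suc m) → Fin (suc n)
lift ρ zero    = zero
lift ρ (suc i) = suc (ρ i)

ren : ∀ {m n} → (Fin m → Fin n) → Term m → Term n
ren ρ 𝟎        = 𝟎
ren ρ (var i)  = var (ρ i)
ren ρ (α ∙ P)  = α ∙ ren ρ P
ren ρ (σ∙ P)   = σ∙ ren ρ P
ren ρ (P ⊕ Q)  = ren ρ P ⊕ ren ρ Q
ren ρ (P ∣∣ Q) = ren ρ P ∣∣ ren ρ Q
ren ρ (P ∖ L)  = ren ρ P ∖ L
ren ρ (P ⟦ f ⟧) = ren ρ P ⟦ f ⟧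
ren ρ (μ P)    = μ ren (lift ρ) P

exts : ∀ {m n} → (Fin m → Term n) → Fin (suc m) → Term (suc n)
exts s zero    = var zero
exts s (suc i) = ren suc (s i)

sub : ∀ {m n} → (Fin m → Term n) → Term m → Term n
sub s 𝟎        = 𝟎
sub s (var i)  = s i
sub s (α ∙ P)  = α ∙ sub s P
sub s (σ∙ P)   = σ∙ sub s P
sub s (P ⊕ Q)  = sub s P ⊕ sub s Q
sub s (P ∣∣ Q) = sub s P ∣∣ sub s Q
sub s (P ∖ L)  = sub s P ∖ L
sub s (P ⟦ f ⟧) = sub s P ⟦ f ⟧
sub s (μ P)    = μ sub (exts s) P

sub0 : ∀ {n} → Term n → Fin (suc n) → Term n
sub0 Q zero    = Q
sub0 Q (suc i) = var i

_[_/x] : ∀ {n} → Term (suc n) → Term n → Term n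
P [ Q /x] = sub (sub0 Q) P

Guarded : ∀ {n} → Fin n → Term n → Set
Guarded i 𝟎         = ⊤
Guarded i (var j)   = i ≢ j
Guarded i (α ∙ P)   = ⊤
Guarded i (σ∙ P)    = Guarded i P
Guarded i (P ⊕ Q)   = Guarded i P × Guarded i Q
Guarded i (P ∣∣ Q)  = Guarded i P × Guarded i Q
Guarded i (P ∖ L)   = Guarded i P
Guarded i (P ⟦ f ⟧) = Guarded i P
Guarded i (μ P)     = Guarded (suc i) P

WF : ∀ {n} → Term n → Set
WF 𝟎         = ⊤
WF (var j)   = ⊤
WF (α ∙ P)   = WF P
WF (σ∙ P)    = WF P
WF (P ⊕ Q)   = WF P × WF Q
WF (P ∣∣ Q)  = WF P × WF Q
WF (P ∖ L)   = WF P
WF (P ⟦ f ⟧) = WF P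
WF (μ P)     = Guarded zero P × WF P

record Proc : Set where
  constructor proc
  field
    term : Term 0
    wf   : WF term
open Proc public

-- Urgent action sets, as predicates on 𝒜.

𝒰 : ∀ {n} → Term n → Act → Set
𝒰 𝟎         β = ⊥
𝒰 (var i)   β = ⊥
𝒰 (α ∙ P)   β = α ≡ β
𝒰 (σ∙ P)    β = ⊥
𝒰 (P ⊕ Q)   β = 𝒰 P β ⊎ 𝒰 Q β
𝒰 (P ∣∣ Q)  β = 𝒰 P β ⊎ 𝒰 Q β
                ⊎ (β ≡ τ × ∃ λ a → 𝒰 P (vis a) × 𝒰 Q (vis (bar a)))
𝒰 (P ∖ L)   β = 𝒰 P β × NotIn L β
𝒰 (P ⟦ f ⟧) β = ∃ λ α → 𝒰 P α × appRel f α ≡ β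
𝒰 (μ P)     β = 𝒰 P β

infix 4 _─[_]→_
data _─[_]→_ {n : ℕ} : Term n → Act → Term n → Set where
  pre   : ∀ {α P} → (α ∙ P) ─[ α ]→ P
  sig   : ∀ {α P P'} → P ─[ α ]→ P' → (σ∙ P) ─[ α ]→ P'
  rec   : ∀ {α P P'} → P ─[ α ]→ P' → (μ P) ─[ α ]→ (P' [ μ P /x])
  sumL  : ∀ {α P P' Q} → P ─[ α ]→ P' → (P ⊕ Q) ─[ α ]→ P'
  sumR  : ∀ {α P P' Q} → P ─[ α ]→ P' → (Q ⊕ P) ─[ α ]→ P'
  parL  : ∀ {α P P' Q} → P ─[ α ]→ P' → (P ∣∣ Q) ─[ α ]→ (P' ∣∣ Q)
  parR  : ∀ {α P P' Q} → P ─[ α ]→ P' → (Q ∣∣ P) ─[ α ]→ (Q ∣∣ P')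
  rel   : ∀ {α P P' f} → P ─[ α ]→ P' → (P ⟦ f ⟧) ─[ appRel f α ]→ (P' ⟦ f ⟧)
  res   : ∀ {α P P' L} → P ─[ α ]→ P' → NotIn L α → (P ∖ L) ─[ α ]→ (P' ∖ L)
  com   : ∀ {a P P' Q Q'} → P ─[ vis a ]→ P' → Q ─[ vis (bar a) ]→ Q'
        → (P ∣∣ Q) ─[ τ ]→ (P' ∣∣ Q')

data Idx : Set where
  ①  : Idx
  ② : Idx

infix 4 _─σ[_]→_
data _─σ[_]→_ {n : ℕ} : Term n → Idx → Term n → Set where
  nil   : ∀ {i} → 𝟎 ─σ[ i ]→ 𝟎
  idle  : ∀ {i a P} → (vis a ∙ P) ─σ[ i ]→ (vis a ∙ P)
  sig   : ∀ {i P} → (σ∙ P) ─σ[ i ]→ P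
  rec   : ∀ {i P P'} → P ─σ[ i ]→ P' → (μ P) ─σ[ i ]→ (P' [ μ P /x])
  res   : ∀ {i P P' L} → P ─σ[ i ]→ P' → (P ∖ L) ─σ[ i ]→ (P' ∖ L)
  rel   : ∀ {i P P' f} → P ─σ[ i ]→ P' → (P ⟦ f ⟧) ─σ[ i ]→ (P' ⟦ f ⟧)
  sum   : ∀ {i P P' Q Q'} → P ─σ[ i ]→ P' → Q ─σ[ i ]→ Q'
        → (P ⊕ Q) ─σ[ i ]→ (P' ⊕ Q')
  par   : ∀ {i P P' Q Q'} → P ─σ[ i ]→ P' → Q ─σ[ i ]→ Q'
        → ¬ 𝒰 (P ∣∣ Q) τ → (P ∣∣ Q) ─σ[ i ]→ (P' ∣∣ Q')
  sig₂  : ∀ {P P'} → P ─σ[ ② ]→ P' → (σ∙ P) ─σ[ ② ]→ P'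

PRel : Set₁
PRel = Proc → Proc → Set

_⊆𝒰_ : Term 0 → Term 0 → Set
Q ⊆𝒰 P = ∀ α → 𝒰 Q α → 𝒰 P α

ActSim : PRel → Set
ActSim R = ∀ P Q → R P Q → ∀ α →
    (∀ P' → term P ─[ α ]→ term P' →
       Σ Proc λ Q' → term Q ─[ α ]→ term Q' × R P' Q')
  × (∀ Q' → term Q ─[ α ]→ term Q' →
       Σ Proc λ P' → term P ─[ α ]→ term P' × R P' Q')

-- clause (3) with P stepping with clock j and Q answering with clock k
ClockSim : Idx → Idx → PRel → Set
ClockSim j k R = ∀ P Q → R P Q → ∀ P' → term P ─σ[ j ]→ term P' →
    (term Q ⊆𝒰 term P)
  × (Σ Proc λ Q' → term Q ─σ[ k ]→ term Q' × R P' Q')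

StrongFaster : Idx → PRel → Set
StrongFaster i R = ActSim R × ClockSim i i R

StrongCFaster : PRel → Set
StrongCFaster R = ActSim R × ClockSim ① ② R

module Submission where

open import Defs
open import Data.Product using (_×_; _,_; map₂)
open import Function using (_∘_)

-- The clock-2 rules are those of clock 1 plus sig₂.
─σ[①]⇒─σ[②] : ∀ {n} {P P' : Term n} → P ─σ[ ① ]→ P' → P ─σ[ ② ]→ P'
─σ[①]⇒─σ[②] nil         = nil
─σ[①]⇒─σ[②] idle        = idle
─σ[①]⇒─σ[②] sig         = sig
─σ[①]⇒─σ[②] (rec s)     = rec (─σ[①]⇒─σ[②] s)
─σ[①]⇒─σ[②] (res s)     = res (─σ[①]⇒─σ[②] s)
─σ[①]⇒─σ[②] (rel s)     = rel (─σ[①]⇒─σ[②] s)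
─σ[①]⇒─σ[②] (sum s t)   = sum (─σ[①]⇒─σ[②] s) (─σ[①]⇒─σ[②] t)
─σ[①]⇒─σ[②] (par s t u) = par (─σ[①]⇒─σ[②] s) (─σ[①]⇒─σ[②] t) u

ClockSim-answer①⇒② : ∀ {j} (R : PRel) → ClockSim j ① R → ClockSim j ② R
ClockSim-answer①⇒② R sim P Q r P' s =
  map₂ (map₂ (λ (t , r') → ─σ[①]⇒─σ[②] t , r')) (sim P Q r P' s)

ClockSim-step②⇒① : ∀ {k} (R : PRel) → ClockSim ② k R → ClockSim ① k R
ClockSim-step②⇒① R sim P Q r P' = sim P Q r P' ∘ ─σ[①]⇒─σ[②]

proposition20 : ((R : PRel) → StrongFaster ① R → StrongCFaster R)
    × ((R : PRel) → StrongFaster ② R → StrongCFaster R)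
proposition20 = (λ R → map₂ (ClockSim-answer①⇒② R))
              , (λ R → map₂ (ClockSim-step②⇒① R))
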